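{- Let $w=\tau_x\overline{w}\in W_a$ with $x\in\mathbb{Z}\Phi$ and $\overline{w}\in W$, and let $\lambda$ be an admitted vector. If $\iota(w)\in X_{W_a}[\lambda]$, then $\iota(\overline{w})\in X_{W_a}[\lambda]$. In particular $X_{W_a}[\lambda]$ is stable under the action of $\mathbb{Z}\Phi$, i.e. $F(\tau_y)(X_{W_a}[\lambda])\subseteq X_{W_a}[\lambda]$ for all $y\in\mathbb{Z}\Phi$.
   Context: Let $V$ be a Euclidean space with inner product $(\cdot,\cdot)$, $\Phi\subset V$ an irreducible crystallographic root system spanning $V$, short roots of norm $1$; $\Delta=\{\alpha_1,\dots,\alpha_n\}$, $\Phi^+$ ($|\Phi^+|=m$), $W$ the Weyl group. $\alpha^\vee=2\alpha/(\alpha,\alpha)$; $s_{\alpha,k}(x)=x-\big(\tfrac{2(\alpha,x)}{(\alpha,\alpha)}-k\big)\alpha$; $W_a=\langle s_{\alpha,k}\rangle=\mathbb{Z}\Phi\rtimes W$, where $\tau_x$ is translation by $x\in\mathbb{Z}\Phi$. For $\alpha\in\Phi^+$, $H^1_{\alpha,k}=\{v:k<(v,\alpha^\vee)<k+1\}$; alcoves are connected components of $V$ minus all $\{(v,\alpha^\vee)=k\}$, $A_e=\bigcap_{\alpha\in\Phi^+}H^1_{\alpha,0}$, $A_w=w(A_e)$, $k(w,\alpha)$ defined by $A_w=\bigcap_{\alpha\in\Phi^+}H^1_{\alpha,k(w,\alpha)}$, $\iota(w)=(k(w,\alpha))_{\alpha\in\Phi^+}\in\mathbb{R}^m$. $F:W_a\to\mathrm{Isom}(\mathbb{R}^m)$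 is the unique homomorphism with $F(w)(\iota(u))=\iota(wu)$ for all $u,w$; $F(\tau_y)$ is the translation by $((y,\alpha^\vee))_{\alpha\in\Phi^+}$. Height $h(\theta^\vee)=\sum c_i$ for $\theta^\vee=\sum_ic_i\alpha_i^\vee$; $P_\theta=\sum_ic_iX_{\alpha_i}$; $I_\theta=\{0,\dots,h(\theta^\vee)-1\}$; $P_\theta[\lambda_\theta]=P_\theta+\lambda_\theta-X_\theta$. $\lambda\in\mathbb{N}^m$ is admissible if $\lambda_\alpha\in I_\alpha$ for all $\alpha\in\Phi^+$, and then $X_{W_a}[\lambda]\subset\mathbb{R}^m$ is the common zero set of the $P_\alpha[\lambda_\alpha]$. $\lambda$ is admitted if it moreover satisfies $\lambda_\alpha+\lambda_\beta\le\lambda_\gamma\le\lambda_\alpha+\lambda_\beta+1$ whenever $\alpha,\beta,\gamma\in\Phi^+$ with $\alpha^\vee+\beta^\vee=\gamma^\vee$.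
   Formalization: The Euclidean space V is taken as ℚ^n in simple-root coordinates, and stability of $X_{W_a}[\lambda]$ under $F(\tau_y)$ is asserted only for its points with rational coordinates rather than all of $\mathbb{R}^m$. -}

module Defs where

open import Data.Nat as ℕ using (ℕ; zero; suc)
open import Data.Integer as ℤ using (ℤ)
open import Data.Rational using (ℚ; 0ℚ; 1ℚ; _+_; _*_; _-_; -_; 1/_; _≤_; _<_; _/_; _≟_; ≢-nonZero)
open import Data.Fin using (Fin; zero; suc)
open import Data.Vec using (Vec; tabulate; lookup; zipWith; map; replicate)
open import Data.List using (List; [])
open import Data.List.Membership.Propositional using (_∈_; _∉_)
open import Data.List.Relation.Unary.All using (All)
open import Data.Product using (Σ; ∃; ∃-syntax; _×_; _,_)
open import Data.Sum using (_⊎_)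
open import Data.Bool using (Bool)
open import Relation.Binary.PropositionalEquality using (_≡_; _≢_)
open import Relation.Nullary using (yes; no)

-- V is modelled as ℚ^n with coordinates taken w.r.t. the simple roots:
-- the i-th simple root α_i is the i-th standard basis vector e i.
-- The Euclidean inner product is given by the Gram matrix G of the
-- simple roots, G i j = (α_i , α_j).

V : ℕ → Set
V n = Vec ℚ n

ℤtoℚ : ℤ → ℚ
ℤtoℚ z = z / 1

ℕtoℚ : ℕ → ℚ
ℕtoℚ k = ℤ.+ k / 1

Σ[<_]_ : (n : ℕ) → (Fin n → ℚ) → ℚ
Σ[< zero ] f = 0ℚ
Σ[< suc n ] f = f zero + Σ[< n ] (λ i → f (suc i))

0v : ∀ {n} → V n
0v = replicate _ 0ℚ

e : ∀ {n} → Fin n → V n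
e i = tabulate (λ j → δ i j)
  where
  δ : ∀ {n} → Fin n → Fin n → ℚ
  δ zero zero = 1ℚ
  δ zero (suc _) = 0ℚ
  δ (suc _) zero = 0ℚ
  δ (suc i) (suc j) = δ i j

_+v_ : ∀ {n} → V n → V n → V n
_+v_ = zipWith _+_

_-v_ : ∀ {n} → V n → V n → V n
_-v_ = zipWith _-_

_·v_ : ∀ {n} → ℚ → V n → V n
c ·v v = map (c *_) v

-- total inverse on ℚ (inv 0 = 0; only ever applied to nonzero values)
inv : ℚ → ℚ
inv q with q ≟ 0ℚ
... | yes _ = 0ℚ
... | no q≢0 = 1/_ q {{≢-nonZero q≢0}}

IsInteger : ℚ → Set
IsInteger q = ∃[ z ] q ≡ ℤtoℚ z

record RootSystem (n : ℕ) : Set where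
  field
    G        : Fin n → Fin n → ℚ
    G-sym    : ∀ i j → G i j ≡ G j i

  ⟪_,_⟫ : V n → V n → ℚ
  ⟪ u , v ⟫ = Σ[< n ] (λ i → Σ[< n ] (λ j → lookup u i * G i j * lookup v j))

  coroot : V n → V n
  coroot α = (ℕtoℚ 2 * inv ⟪ α , α ⟫) ·v α

  refl-vec : V n → V n → V n
  refl-vec α v = v -v (⟪ v , coroot α ⟫ ·v α)

  field
    G-posdef : ∀ v → v ≢ 0v → 0ℚ < ⟪ v , v ⟫
    Φ        : List (V n)
    -- (R1) 0 ∉ Φ  (finiteness: Φ is a list; spanning: Δ ⊆ Φ is a basis)
    zero∉Φ   : 0v ∉ Φ
    reduced  : ∀ {α} → α ∈ Φ → ∀ c → (c ·v α) ∈ Φ → c ≡ 1ℚ ⊎ c ≡ - 1ℚ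
    refl-closed : ∀ {α β} → α ∈ Φ → β ∈ Φ → refl-vec α β ∈ Φ
    crystallographic : ∀ {α β} → α ∈ Φ → β ∈ Φ → IsInteger ⟪ β , coroot α ⟫
    simple∈Φ : ∀ i → e i ∈ Φ
    simple-sign : ∀ {α} → α ∈ Φ →
      (∀ i → 0ℚ ≤ lookup α i) ⊎ (∀ i → lookup α i ≤ 0ℚ)
    -- irreducible: no decomposition Φ = Φ₁ ⊔ Φ₂ into mutually orthogonal
    -- nonempty parts (a part is given by a colouring c : V n → Bool)
    irreducible : ∀ (c : V n → Bool) →
      (∀ {α β} → α ∈ Φ → β ∈ Φ → c α ≢ c β → ⟪ α , β ⟫ ≡ 0ℚ) →
      ∀ {α β} → α ∈ Φ → β ∈ Φ → c α ≡ c β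
    norm≥1 : ∀ {α} → α ∈ Φ → 1ℚ ≤ ⟪ α , α ⟫
    short  : ∃[ α ] (α ∈ Φ × ⟪ α , α ⟫ ≡ 1ℚ)

  _∈Φ⁺ : V n → Set
  α ∈Φ⁺ = α ∈ Φ × (∀ i → 0ℚ ≤ lookup α i)

  -- simple coroots α_i^∨ = coroot (e i); for θ ∈ Φ⁺, θ^∨ = Σ_i c_i α_i^∨ with
  -- c_i = (θ^∨)_i · (α_i, α_i) / 2
  corootCoeff : V n → Fin n → ℚ
  corootCoeff θ i = lookup (coroot θ) i * ⟪ e i , e i ⟫ * inv (ℕtoℚ 2)

  height : V n → ℚ
  height θ = Σ[< n ] (corootCoeff θ)

  data _∈ℤΦ : V n → Set where
    zeroℤΦ : 0v ∈ℤΦ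
    addℤΦ  : ∀ {α x} → α ∈ Φ → x ∈ℤΦ → (x +v α) ∈ℤΦ
    subℤΦ  : ∀ {α x} → α ∈ Φ → x ∈ℤΦ → (x -v α) ∈ℤΦ

  -- Elements of W: words s_{β₁} ⋯ s_{β_k} in the generating reflections
  data WWord : Set where
    []W  : WWord
    _∷W_ : (β : V n) → β ∈ Φ → WWord → WWord

  actW : WWord → V n → V n
  actW []W v = v
  actW (_∷W_ β _ w) v = refl-vec β (actW w v)

  -- action of w = τ_x w̄ ∈ W_a on V
  actWa : V n → WWord → V n → V n
  actWa x w̄ v = x +v actW w̄ v

  -- fundamental alcove A_e (its rational points)
  _∈Aₑ : V n → Set
  v ∈Aₑ = ∀ {α} → α ∈Φ⁺ → (0ℚ < ⟪ v , coroot α ⟫) × (⟪ v , coroot α ⟫ < 1ℚ)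

  -- κ = ι(τ_x w̄), i.e. κ α = k(τ_x w̄, α) for α ∈ Φ⁺:
  -- A_{τ_x w̄} = τ_x w̄ (A_e) ⊆ H¹_{α, κ α} for every positive root α.
  -- Points of ℝ^m are modelled as functions V n → ℚ, read only on Φ⁺.
  IsIota : V n → WWord → (V n → ℤ) → Set
  IsIota x w̄ κ = ∀ {α} → α ∈Φ⁺ → ∀ v → v ∈Aₑ →
    (ℤtoℚ (κ α) < ⟪ actWa x w̄ v , coroot α ⟫) ×
    (⟪ actWa x w̄ v , coroot α ⟫ < ℤtoℚ (κ α) + 1ℚ)

  P[_]_at_ : ℕ → V n → (V n → ℚ) → ℚ
  P[ l ] θ at p = Σ[< n ] (λ i → corootCoeff θ i * p (e i)) + ℕtoℚ l - p θ

  Admissible : (V n → ℕ) → Set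
  Admissible λ' = ∀ {α} → α ∈Φ⁺ → ℕtoℚ (suc (λ' α)) ≤ height α

  Admitted : (V n → ℕ) → Set
  Admitted λ' = Admissible λ' ×
    (∀ {α β γ} → α ∈Φ⁺ → β ∈Φ⁺ → γ ∈Φ⁺ → (coroot α +v coroot β) ≡ coroot γ →
      (λ' α ℕ.+ λ' β ℕ.≤ λ' γ) × (λ' γ ℕ.≤ λ' α ℕ.+ λ' β ℕ.+ 1))

  _∈X[_] : (V n → ℚ) → (V n → ℕ) → Set
  p ∈X[ λ' ] = ∀ {θ} → θ ∈Φ⁺ → P[ λ' θ ] θ at p ≡ 0ℚ

  Fτ : V n → (V n → ℚ) → (V n → ℚ)
  Fτ y p α = p α + ⟪ y , coroot α ⟫

{-# OPTIONS --safe #-}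
module Submission where

-- Since θ^∨ = Σ c_i α_i^∨, every P_θ[λ_θ] is unchanged by the translation F(τ_y) for any y,
-- which is the second claim. For the first, fix a rational point v of A_e: k(τ_x w̄, α) and
-- k(w̄, α) are the integer parts of (x + w̄v, α^∨) and (w̄v, α^∨), which differ by the integer
-- (x, α^∨); hence ι(τ_x w̄) = F(τ_x) ι(w̄). Such a v exists because the Gram matrix is positive
-- definite: eliminating by Schur complements gives ρ with (ρ, α_i) = 1 for all i, and a small
-- positive multiple of ρ lies in A_e.

open import Data.Empty using (⊥-elim)
open import Data.Fin using (Fin; zero; suc)
open import Data.Integer as ℤ using (ℤ)
import Data.Integer.Properties as ℤ
open import Data.List using (List; []; _∷_)
open import Data.List.Membership.Propositional using (_∈_)
open import Data.List.Relation.Unary.Any using (here; there)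
open import Data.Nat using (ℕ; zero; suc)
import Data.Nat.Coprimality as Coprimality
open import Data.Product using (Σ; _×_; _,_; proj₁; proj₂)
open import Data.Rational
import Data.Rational.Unnormalised as ℚᵘ
import Data.Rational.Unnormalised.Properties as ℚᵘ
open import Data.Rational.Properties
open import Data.Rational.Solver using (module +-*-Solver)
open import Data.Sum using (_⊎_; inj₁; inj₂)
open import Data.Vec using (lookup; tabulate)
open import Data.Vec.Functional using (Vector) renaming (_∷_ to _∷ᶠ_)
open import Data.Vec.Properties
  using (lookup∘tabulate; lookup-zipWith; lookup-map; lookup-replicate)
open import Relation.Binary.Definitions using (tri<; tri≈; tri>)
open import Relation.Binary.PropositionalEquality
open import Relation.Nullary using (yes; no)

open import Defs

open +-*-Solver
open ≡-Reasoning

Σ-cong : ∀ {n} {f g : Fin n → ℚ} → (∀ i → f i ≡ g i) → Σ[< n ] f ≡ Σ[< n ] g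
Σ-cong {zero}  f≗g = refl
Σ-cong {suc n} f≗g = cong₂ _+_ (f≗g zero) (Σ-cong (λ i → f≗g (suc i)))

Σ-zero : ∀ n → Σ[< n ] (λ _ → 0ℚ) ≡ 0ℚ
Σ-zero zero    = refl
Σ-zero (suc n) = cong (0ℚ +_) (Σ-zero n)

Σ-+ : ∀ {n} (f g : Fin n → ℚ) → Σ[< n ] (λ i → f i + g i) ≡ Σ[< n ] f + Σ[< n ] g
Σ-+ {zero}  f g = refl
Σ-+ {suc n} f g = begin
  f zero + g zero + Σ[< n ] (λ i → f (suc i) + g (suc i))
    ≡⟨ cong (f zero + g zero +_) (Σ-+ (λ i → f (suc i)) (λ i → g (suc i))) ⟩
  f zero + g zero + (Σ[< n ] (λ i → f (suc i)) + Σ[< n ] (λ i → g (suc i)))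
    ≡⟨ solve 4 (λ a b c d → a :+ b :+ (c :+ d) := a :+ c :+ (b :+ d)) refl
         (f zero) (g zero) (Σ[< n ] (λ i → f (suc i))) (Σ[< n ] (λ i → g (suc i))) ⟩
  f zero + Σ[< n ] (λ i → f (suc i)) + (g zero + Σ[< n ] (λ i → g (suc i))) ∎

Σ-*ˡ : ∀ {n} c (f : Fin n → ℚ) → Σ[< n ] (λ i → c * f i) ≡ c * Σ[< n ] f
Σ-*ˡ {zero}  c f = sym (*-zeroʳ c)
Σ-*ˡ {suc n} c f =
  trans (cong (c * f zero +_) (Σ-*ˡ c (λ i → f (suc i)))) (sym (*-distribˡ-+ c _ _))

Σ-*ʳ : ∀ {n} c (f : Fin n → ℚ) → Σ[< n ] (λ i → f i * c) ≡ Σ[< n ] f * c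
Σ-*ʳ c f = trans (Σ-cong (λ i → *-comm (f i) c)) (trans (Σ-*ˡ c f) (*-comm c _))

Σ-swap : ∀ {n m} (f : Fin n → Fin m → ℚ) →
  Σ[< n ] (λ i → Σ[< m ] (f i)) ≡ Σ[< m ] (λ j → Σ[< n ] (λ i → f i j))
Σ-swap {zero}  {m} f = sym (Σ-zero m)
Σ-swap {suc n} {m} f = begin
  Σ[< m ] (f zero) + Σ[< n ] (λ i → Σ[< m ] (f (suc i)))
    ≡⟨ cong (Σ[< m ] (f zero) +_) (Σ-swap (λ i → f (suc i))) ⟩
  Σ[< m ] (f zero) + Σ[< m ] (λ j → Σ[< n ] (λ i → f (suc i) j))
    ≡⟨ sym (Σ-+ (f zero) _) ⟩
  Σ[< m ] (λ j → f zero j + Σ[< n ] (λ i → f (suc i) j)) ∎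

Σ-e : ∀ {n} (i : Fin n) (f : Fin n → ℚ) → Σ[< n ] (λ j → lookup (e i) j * f j) ≡ f i
Σ-e {suc n} zero f = begin
  1ℚ * f zero + Σ[< n ] (λ j → lookup (tabulate (λ _ → 0ℚ)) j * f (suc j))
    ≡⟨ cong₂ _+_ (*-identityˡ (f zero)) (trans (Σ-cong vanish) (Σ-zero n)) ⟩
  f zero + 0ℚ
    ≡⟨ +-identityʳ (f zero) ⟩
  f zero ∎
  where
  vanish : ∀ j → lookup (tabulate (λ _ → 0ℚ)) j * f (suc j) ≡ 0ℚ
  vanish j = trans (cong (_* f (suc j)) (lookup∘tabulate _ j)) (*-zeroˡ (f (suc j)))
Σ-e {suc n} (suc i) f =
  trans (cong₂ _+_ (*-zeroˡ (f zero)) (Σ-e i (λ j → f (suc j)))) (+-identityˡ _)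

Σ-pos⊎zero : ∀ {n} (f : Fin n → ℚ) → (∀ i → 0ℚ ≤ f i) →
  0ℚ < Σ[< n ] f ⊎ (∀ i → f i ≡ 0ℚ)
Σ-pos⊎zero {zero}  f f≥0 = inj₂ (λ ())
Σ-pos⊎zero {suc n} f f≥0 with Σ-pos⊎zero (λ i → f (suc i)) (λ i → f≥0 (suc i))
... | inj₁ tail>0 = inj₁ (subst (_< Σ[< suc n ] f) (+-identityˡ 0ℚ) (+-mono-≤-< (f≥0 zero) tail>0))
... | inj₂ tail≡0 with <-cmp 0ℚ (f zero)
...   | tri< head>0 _ _ = inj₁ (subst (_< Σ[< suc n ] f) (+-identityʳ 0ℚ)
          (+-mono-<-≤ head>0 (≤-reflexive (sym (trans (Σ-cong tail≡0) (Σ-zero n))))))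
...   | tri≈ _ head≡0 _ = inj₂ λ { zero → sym head≡0 ; (suc i) → tail≡0 i }
...   | tri> _ _ head<0 = ⊥-elim (<-irrefl refl (≤-<-trans (f≥0 zero) head<0))

inv-inverseʳ : ∀ q → q ≢ 0ℚ → q * inv q ≡ 1ℚ
inv-inverseʳ q q≢0 with q ≟ 0ℚ
... | yes q≡0 = ⊥-elim (q≢0 q≡0)
... | no q≢0′ = *-inverseʳ q {{≢-nonZero q≢0′}}

inv-pos : ∀ {q} → 0ℚ < q → 0ℚ < inv q
inv-pos {q} q>0 with q ≟ 0ℚ
... | yes q≡0 = ⊥-elim (<-irrefl (sym q≡0) q>0)
... | no q≢0  = positive⁻¹ _ {{1/pos⇒pos q {{positive q>0}}}}

*-pos : ∀ {p q} → 0ℚ < p → 0ℚ < q → 0ℚ < p * q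
*-pos {p} {q} p>0 q>0 = positive⁻¹ _ {{pos*pos⇒pos p {{positive p>0}} q {{positive q>0}}}}

0<1 : 0ℚ < 1ℚ
0<1 = positive⁻¹ 1ℚ

0<2 : 0ℚ < ℕtoℚ 2
0<2 = positive⁻¹ (ℕtoℚ 2)

mkℚ[_/1] : ℤ → ℚ
mkℚ[ z /1] = mkℚ z 0 (Coprimality.sym (Coprimality.1-coprimeTo _))

ℤtoℚ≡mkℚ : ∀ z → ℤtoℚ z ≡ mkℚ[ z /1]
ℤtoℚ≡mkℚ z = ↥p/↧p≡p mkℚ[ z /1]

ℤtoℚ-+ : ∀ z w → ℤtoℚ (z ℤ.+ w) ≡ ℤtoℚ z + ℤtoℚ w
ℤtoℚ-+ z w rewrite ℤtoℚ≡mkℚ (z ℤ.+ w) | ℤtoℚ≡mkℚ z | ℤtoℚ≡mkℚ w =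
  toℚᵘ-injective (ℚᵘ.≃-trans (ℚᵘ.*≡* cross) (ℚᵘ.≃-sym (toℚᵘ-homo-+ mkℚ[ z /1] mkℚ[ w /1])))
  where
  cross : (z ℤ.+ w) ℤ.* ℤ.1ℤ ≡ (z ℤ.* ℤ.1ℤ ℤ.+ w ℤ.* ℤ.1ℤ) ℤ.* ℤ.1ℤ
  cross = trans (ℤ.*-identityʳ _)
    (sym (trans (ℤ.*-identityʳ _) (cong₂ ℤ._+_ (ℤ.*-identityʳ z) (ℤ.*-identityʳ w))))

ℤtoℚ-neg : ∀ z → ℤtoℚ (ℤ.- z) ≡ - ℤtoℚ z
ℤtoℚ-neg z rewrite ℤtoℚ≡mkℚ (ℤ.- z) | ℤtoℚ≡mkℚ z = mkℚ-neg z
  where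
  mkℚ-neg : ∀ z → mkℚ[ ℤ.- z /1] ≡ - mkℚ[ z /1]
  mkℚ-neg (ℤ.+ zero)   = refl
  mkℚ-neg ℤ.+[1+ n ]   = refl
  mkℚ-neg ℤ.-[1+ n ]   = refl

ℤtoℚ-cancel-< : ∀ {z w} → ℤtoℚ z < ℤtoℚ w → z ℤ.< w
ℤtoℚ-cancel-< {z} {w} z<w rewrite ℤtoℚ≡mkℚ z | ℤtoℚ≡mkℚ w with z<w
... | *<* z*1<w*1 = subst₂ ℤ._<_ (ℤ.*-identityʳ z) (ℤ.*-identityʳ w) z*1<w*1

IsInteger-+ : ∀ {p q} → IsInteger p → IsInteger q → IsInteger (p + q)
IsInteger-+ (z , refl) (w , refl) = z ℤ.+ w , sym (ℤtoℚ-+ z w)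

IsInteger-- : ∀ {p q} → IsInteger p → IsInteger q → IsInteger (p - q)
IsInteger-- (z , refl) (w , refl) =
  z ℤ.- w , sym (trans (ℤtoℚ-+ z (ℤ.- w)) (cong (ℤtoℚ z +_) (ℤtoℚ-neg w)))

ℤtoℚ-floor-≤ : ∀ {a b q} → ℤtoℚ a < q → q < ℤtoℚ b + 1ℚ → a ℤ.≤ b
ℤtoℚ-floor-≤ {a} {b} a<q q<b+1 = ℤ.≮⇒≥ λ b<a →
  ℤ.<-irrefl refl (ℤ.<-≤-trans a<1+b (ℤ.i<j⇒suc[i]≤j b<a))
  where
  a<1+b : a ℤ.< ℤ.1ℤ ℤ.+ b
  a<1+b = ℤtoℚ-cancel-<
    (subst (ℤtoℚ a <_) (trans (+-comm (ℤtoℚ b) 1ℚ) (sym (ℤtoℚ-+ ℤ.1ℤ b))) (<-trans a<q q<b+1))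

InOpenUnit : ℤ → ℚ → Set
InOpenUnit k q = ℤtoℚ k < q × q < ℤtoℚ k + 1ℚ

InOpenUnit-unique : ∀ {a b q} → InOpenUnit a q → InOpenUnit b q → a ≡ b
InOpenUnit-unique (a<q , q<a+1) (b<q , q<b+1) =
  ℤ.≤-antisym (ℤtoℚ-floor-≤ a<q q<b+1) (ℤtoℚ-floor-≤ b<q q<a+1)

InOpenUnit-+ : ∀ z {k q} → InOpenUnit k q → InOpenUnit (z ℤ.+ k) (ℤtoℚ z + q)
InOpenUnit-+ z {k} {q} (k<q , q<k+1) =
    subst (_< ℤtoℚ z + q) (sym (ℤtoℚ-+ z k)) (+-monoʳ-< (ℤtoℚ z) k<q)
  , subst (ℤtoℚ z + q <_) z+[k+1]≡ (+-monoʳ-< (ℤtoℚ z) q<k+1)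
  where
  z+[k+1]≡ : ℤtoℚ z + (ℤtoℚ k + 1ℚ) ≡ ℤtoℚ (z ℤ.+ k) + 1ℚ
  z+[k+1]≡ = trans (sym (+-assoc (ℤtoℚ z) (ℤtoℚ k) 1ℚ)) (cong (_+ 1ℚ) (sym (ℤtoℚ-+ z k)))

Matrix : ℕ → Set
Matrix n = Fin n → Fin n → ℚ

_⊙_ : ∀ {n} → Matrix n → Vector ℚ n → Vector ℚ n
(G ⊙ v) i = Σ[< _ ] (λ j → G i j * v j)

quadForm : ∀ {n} → Matrix n → Vector ℚ n → ℚ
quadForm G u = Σ[< _ ] (λ i → u i * (G ⊙ u) i)

SymmetricMatrix : ∀ {n} → Matrix n → Set
SymmetricMatrix G = ∀ i j → G i j ≡ G j i

PositiveDefinite : ∀ {n} → Matrix n → Set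
PositiveDefinite G = ∀ u k → u k ≢ 0ℚ → 0ℚ < quadForm G u

module SchurComplement {n} (G : Matrix (suc n)) (G-sym : SymmetricMatrix G) where

  a : ℚ
  a = G zero zero

  b : Vector ℚ n
  b j = G zero (suc j)

  G′ : Matrix n
  G′ i j = G (suc i) (suc j)

  S : Matrix n
  S i j = G′ i j - b i * b j * inv a

  S-sym : SymmetricMatrix S
  S-sym i j = cong₂ (λ g c → g - c * inv a) (G-sym (suc i) (suc j)) (*-comm (b i) (b j))

  ⟨b,_⟩ : Vector ℚ n → ℚ
  ⟨b, v ⟩ = Σ[< n ] (λ j → b j * v j)

  S⊙ : ∀ v i → (S ⊙ v) i ≡ (G′ ⊙ v) i - b i * inv a * ⟨b, v ⟩
  S⊙ v i = begin
    Σ[< n ] (λ j → (G′ i j - b i * b j * inv a) * v j)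
      ≡⟨ Σ-cong (λ j → solve 5 (λ g bi bj ia x → (g :- bi :* bj :* ia) :* x :=
           g :* x :+ (:- (bi :* ia)) :* (bj :* x)) refl (G′ i j) (b i) (b j) (inv a) (v j)) ⟩
    Σ[< n ] (λ j → G′ i j * v j + (- (b i * inv a)) * (b j * v j))
      ≡⟨ Σ-+ (λ j → G′ i j * v j) (λ j → (- (b i * inv a)) * (b j * v j)) ⟩
    (G′ ⊙ v) i + Σ[< n ] (λ j → (- (b i * inv a)) * (b j * v j))
      ≡⟨ cong ((G′ ⊙ v) i +_) (Σ-*ˡ (- (b i * inv a)) (λ j → b j * v j)) ⟩
    (G′ ⊙ v) i + (- (b i * inv a)) * ⟨b, v ⟩
      ≡⟨ solve 4 (λ x bi ia y → x :+ (:- (bi :* ia)) :* y := x :- bi :* ia :* y)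
           refl ((G′ ⊙ v) i) (b i) (inv a) ⟨b, v ⟩ ⟩
    (G′ ⊙ v) i - b i * inv a * ⟨b, v ⟩ ∎

  quadForm-∷ : ∀ c u → quadForm G (c ∷ᶠ u) ≡ c * a * c + (c * ⟨b, u ⟩ + c * ⟨b, u ⟩) + quadForm G′ u
  quadForm-∷ c u = begin
    c * (a * c + ⟨b, u ⟩) + Σ[< n ] (λ i → u i * (G (suc i) zero * c + (G′ ⊙ u) i))
      ≡⟨ cong (c * (a * c + ⟨b, u ⟩) +_) 
           (trans (Σ-cong column) (Σ-+ (λ i → c * (b i * u i)) (λ i → u i * (G′ ⊙ u) i))) ⟩
    c * (a * c + ⟨b, u ⟩) + (Σ[< n ] (λ i → c * (b i * u i)) + quadForm G′ u)
      ≡⟨ cong (λ s → c * (a * c + ⟨b, u ⟩) + (s + quadForm G′ u)) (Σ-*ˡ c (λ i → b i * u i)) ⟩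
    c * (a * c + ⟨b, u ⟩) + (c * ⟨b, u ⟩ + quadForm G′ u)
      ≡⟨ solve 4 (λ c a B q → c :* (a :* c :+ B) :+ (c :* B :+ q) := c :* a :* c :+ (c :* B :+ c :* B) :+ q)
           refl c a ⟨b, u ⟩ (quadForm G′ u) ⟩
    c * a * c + (c * ⟨b, u ⟩ + c * ⟨b, u ⟩) + quadForm G′ u ∎
    where
    column : ∀ i → u i * (G (suc i) zero * c + (G′ ⊙ u) i) ≡ c * (b i * u i) + u i * (G′ ⊙ u) i
    column i = trans (cong (λ g → u i * (g * c + (G′ ⊙ u) i)) (G-sym (suc i) zero))
      (solve 4 (λ x g c y → x :* (g :* c :+ y) := c :* (g :* x) :+ x :* y) refl (u i) (b i) c ((G′ ⊙ u) i))

  quadForm-S : ∀ u → quadForm S u ≡ quadForm G′ u - ⟨b, u ⟩ * ⟨b, u ⟩ * inv a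
  quadForm-S u = begin
    Σ[< n ] (λ i → u i * (S ⊙ u) i)
      ≡⟨ Σ-cong (λ i → cong (u i *_) (S⊙ u i)) ⟩
    Σ[< n ] (λ i → u i * ((G′ ⊙ u) i - b i * inv a * ⟨b, u ⟩))
      ≡⟨ Σ-cong (λ i → solve 5 (λ x y bi ia B → x :* (y :- bi :* ia :* B) := x :* y :+ (bi :* x) :* (:- (ia :* B)))
           refl (u i) ((G′ ⊙ u) i) (b i) (inv a) ⟨b, u ⟩) ⟩
    Σ[< n ] (λ i → u i * (G′ ⊙ u) i + b i * u i * (- (inv a * ⟨b, u ⟩)))
      ≡⟨ trans (Σ-+ (λ i → u i * (G′ ⊙ u) i) (λ i → b i * u i * (- (inv a * ⟨b, u ⟩))))
           (cong (quadForm G′ u +_) (Σ-*ʳ (- (inv a * ⟨b, u ⟩)) (λ i → b i * u i))) ⟩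
    quadForm G′ u + ⟨b, u ⟩ * (- (inv a * ⟨b, u ⟩))
      ≡⟨ solve 3 (λ q B ia → q :+ B :* (:- (ia :* B)) := q :- B :* B :* ia) refl (quadForm G′ u) ⟨b, u ⟩ (inv a) ⟩
    quadForm G′ u - ⟨b, u ⟩ * ⟨b, u ⟩ * inv a ∎

  module _ (G-pd : PositiveDefinite G) where

    a-pos : 0ℚ < a
    a-pos = subst (0ℚ <_) unit (G-pd (1ℚ ∷ᶠ λ _ → 0ℚ) zero 1≢0)
      where
      ⟨b,0⟩ : ⟨b, (λ _ → 0ℚ) ⟩ ≡ 0ℚ
      ⟨b,0⟩ = trans (Σ-cong (λ j → *-zeroʳ (b j))) (Σ-zero n)
      G′0 : quadForm G′ (λ _ → 0ℚ) ≡ 0ℚ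
      G′0 = trans (Σ-cong (λ i → *-zeroˡ ((G′ ⊙ (λ _ → 0ℚ)) i))) (Σ-zero n)
      unit : quadForm G (1ℚ ∷ᶠ λ _ → 0ℚ) ≡ a
      unit = begin
        quadForm G (1ℚ ∷ᶠ λ _ → 0ℚ)
          ≡⟨ quadForm-∷ 1ℚ (λ _ → 0ℚ) ⟩
        1ℚ * a * 1ℚ + (1ℚ * ⟨b, (λ _ → 0ℚ) ⟩ + 1ℚ * ⟨b, (λ _ → 0ℚ) ⟩) + quadForm G′ (λ _ → 0ℚ)
          ≡⟨ cong₂ (λ B q → 1ℚ * a * 1ℚ + (1ℚ * B + 1ℚ * B) + q) ⟨b,0⟩ G′0 ⟩
        1ℚ * a * 1ℚ + (1ℚ * 0ℚ + 1ℚ * 0ℚ) + 0ℚ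
          ≡⟨ solve 1 (λ a → con 1ℚ :* a :* con 1ℚ :+ (con 1ℚ :* con 0ℚ :+ con 1ℚ :* con 0ℚ) :+ con 0ℚ := a)
               refl a ⟩
        a ∎

    a*inv-a : a * inv a ≡ 1ℚ
    a*inv-a = inv-inverseʳ a (λ a≡0 → <-irrefl (sym a≡0) a-pos)

    quadForm-completeSquare : ∀ u → quadForm G ((- (⟨b, u ⟩ * inv a)) ∷ᶠ u) ≡ quadForm S u
    quadForm-completeSquare u = begin
      quadForm G (c ∷ᶠ u)
        ≡⟨ quadForm-∷ c u ⟩
      c * a * c + (c * B + c * B) + quadForm G′ u
        ≡⟨ solve 4 (λ B ia a q → (:- (B :* ia)) :* a :* (:- (B :* ia)) :+ ((:- (B :* ia)) :* B :+ (:- (B :* ia)) :* B) :+ q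
             := B :* B :* ia :* (a :* ia) :+ (q :- B :* B :* ia :- B :* B :* ia)) refl B (inv a) a (quadForm G′ u) ⟩
      B * B * inv a * (a * inv a) + (quadForm G′ u - B * B * inv a - B * B * inv a)
        ≡⟨ cong (λ t → B * B * inv a * t + (quadForm G′ u - B * B * inv a - B * B * inv a)) a*inv-a ⟩
      B * B * inv a * 1ℚ + (quadForm G′ u - B * B * inv a - B * B * inv a)
        ≡⟨ solve 3 (λ B ia q → B :* B :* ia :* con 1ℚ :+ (q :- B :* B :* ia :- B :* B :* ia) := q :- B :* B :* ia)
             refl B (inv a) (quadForm G′ u) ⟩
      quadForm G′ u - B * B * inv a
        ≡⟨ sym (quadForm-S u) ⟩
      quadForm S u ∎
      where
      B = ⟨b, u ⟩
      c = - (B * inv a)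

    S-pd : PositiveDefinite S
    S-pd u k u≢0 = subst (0ℚ <_) (quadForm-completeSquare u) (G-pd ((- (⟨b, u ⟩ * inv a)) ∷ᶠ u) (suc k) u≢0)

    lift-solution : ∀ (r : Vector ℚ (suc n)) (v : Vector ℚ n) →
      (∀ i → (S ⊙ v) i ≡ r (suc i) - b i * r zero * inv a) →
      ∀ i → (G ⊙ (((r zero - ⟨b, v ⟩) * inv a) ∷ᶠ v)) i ≡ r i
    lift-solution r v Sv≡ zero = begin
      a * ((r zero - ⟨b, v ⟩) * inv a) + ⟨b, v ⟩
        ≡⟨ solve 4 (λ a r B ia → a :* ((r :- B) :* ia) :+ B := (r :- B) :* (a :* ia) :+ B) refl a (r zero) ⟨b, v ⟩ (inv a) ⟩
      (r zero - ⟨b, v ⟩) * (a * inv a) + ⟨b, v ⟩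
        ≡⟨ cong (λ t → (r zero - ⟨b, v ⟩) * t + ⟨b, v ⟩) a*inv-a ⟩
      (r zero - ⟨b, v ⟩) * 1ℚ + ⟨b, v ⟩
        ≡⟨ solve 2 (λ r B → (r :- B) :* con 1ℚ :+ B := r) refl (r zero) ⟨b, v ⟩ ⟩
      r zero ∎
    lift-solution r v Sv≡ (suc i) = begin
      G (suc i) zero * ((r zero - ⟨b, v ⟩) * inv a) + (G′ ⊙ v) i
        ≡⟨ cong₂ (λ g x → g * ((r zero - ⟨b, v ⟩) * inv a) + x) (G-sym (suc i) zero) G′v≡ ⟩
      b i * ((r zero - ⟨b, v ⟩) * inv a) + (r (suc i) - b i * r zero * inv a + b i * inv a * ⟨b, v ⟩)
        ≡⟨ solve 5 (λ bi r₀ B ia rᵢ → bi :* ((r₀ :- B) :* ia) :+ (rᵢ :- bi :* r₀ :* ia :+ bi :* ia :* B) := rᵢ)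
             refl (b i) (r zero) ⟨b, v ⟩ (inv a) (r (suc i)) ⟩
      r (suc i) ∎
      where
      G′v≡ : (G′ ⊙ v) i ≡ r (suc i) - b i * r zero * inv a + b i * inv a * ⟨b, v ⟩
      G′v≡ = trans (solve 2 (λ x c → x := x :- c :+ c) refl ((G′ ⊙ v) i) (b i * inv a * ⟨b, v ⟩))
        (cong (_+ b i * inv a * ⟨b, v ⟩) (trans (sym (S⊙ v i)) (Sv≡ i)))

posDef-solve : ∀ {n} (G : Matrix n) → SymmetricMatrix G → PositiveDefinite G →
  (r : Vector ℚ n) → Σ (Vector ℚ n) (λ v → ∀ i → (G ⊙ v) i ≡ r i)
posDef-solve {zero}  G G-sym G-pd r = (λ ()) , (λ ())
posDef-solve {suc n} G G-sym G-pd r =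
  let v , Sv≡ = posDef-solve S S-sym (S-pd G-pd) (λ i → r (suc i) - b i * r zero * inv a)
  in ((r zero - ⟨b, v ⟩) * inv a) ∷ᶠ v , lift-solution G-pd r v Sv≡
  where open SchurComplement G G-sym

list-bounded : ∀ {A : Set} (f : A → ℚ) (L : List A) →
  Σ ℚ (λ M → 0ℚ ≤ M × (∀ {x} → x ∈ L → f x ≤ M))
list-bounded f [] = 0ℚ , ≤-refl , λ ()
list-bounded f (x ∷ L) with list-bounded f L
... | M , M≥0 , bound = f x ⊔ M , ≤-trans M≥0 (p≤q⊔p (f x) M) , λ
  { (here refl)  → p≤p⊔q (f x) M
  ; (there x∈L) → ≤-trans (bound x∈L) (p≤q⊔p (f x) M)
  }

module RootSystemFacts {n} (R : RootSystem n) where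
  open RootSystem R

  ⟪⟫-row : ∀ u w → ⟪ u , w ⟫ ≡ Σ[< n ] (λ i → lookup u i * (G ⊙ lookup w) i)
  ⟪⟫-row u w = Σ-cong λ i → trans (Σ-cong (λ j → *-assoc (lookup u i) (G i j) (lookup w j)))
    (Σ-*ˡ (lookup u i) (λ j → G i j * lookup w j))

  ⟪⟫-sym : ∀ u w → ⟪ u , w ⟫ ≡ ⟪ w , u ⟫
  ⟪⟫-sym u w = trans (Σ-swap (λ i j → lookup u i * G i j * lookup w j))
    (Σ-cong λ j → Σ-cong λ i → trans (cong (λ g → lookup u i * g * lookup w j) (G-sym i j))
      (solve 3 (λ x g y → x :* g :* y := y :* g :* x) refl (lookup u i) (G j i) (lookup w j)))

  ⟪⟫-+ˡ : ∀ u w z → ⟪ u +v w , z ⟫ ≡ ⟪ u , z ⟫ + ⟪ w , z ⟫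
  ⟪⟫-+ˡ u w z = begin
    ⟪ u +v w , z ⟫
      ≡⟨ ⟪⟫-row (u +v w) z ⟩
    Σ[< n ] (λ i → lookup (u +v w) i * Gz i)
      ≡⟨ Σ-cong (λ i → trans (cong (_* Gz i) (lookup-zipWith _+_ i u w))
           (*-distribʳ-+ (Gz i) (lookup u i) (lookup w i))) ⟩
    Σ[< n ] (λ i → lookup u i * Gz i + lookup w i * Gz i)
      ≡⟨ Σ-+ (λ i → lookup u i * Gz i) (λ i → lookup w i * Gz i) ⟩
    Σ[< n ] (λ i → lookup u i * Gz i) + Σ[< n ] (λ i → lookup w i * Gz i)
      ≡⟨ sym (cong₂ _+_ (⟪⟫-row u z) (⟪⟫-row w z)) ⟩
    ⟪ u , z ⟫ + ⟪ w , z ⟫ ∎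
    where Gz = G ⊙ lookup z

  ⟪⟫-·ˡ : ∀ c u z → ⟪ c ·v u , z ⟫ ≡ c * ⟪ u , z ⟫
  ⟪⟫-·ˡ c u z = begin
    ⟪ c ·v u , z ⟫
      ≡⟨ ⟪⟫-row (c ·v u) z ⟩
    Σ[< n ] (λ i → lookup (c ·v u) i * Gz i)
      ≡⟨ Σ-cong (λ i → trans (cong (_* Gz i) (lookup-map i (c *_) u)) (*-assoc c (lookup u i) (Gz i))) ⟩
    Σ[< n ] (λ i → c * (lookup u i * Gz i))
      ≡⟨ Σ-*ˡ c (λ i → lookup u i * Gz i) ⟩
    c * Σ[< n ] (λ i → lookup u i * Gz i)
      ≡⟨ cong (c *_) (sym (⟪⟫-row u z)) ⟩
    c * ⟪ u , z ⟫ ∎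
    where Gz = G ⊙ lookup z

  ⟪⟫-·ʳ : ∀ c u w → ⟪ u , c ·v w ⟫ ≡ c * ⟪ u , w ⟫
  ⟪⟫-·ʳ c u w = trans (⟪⟫-sym u (c ·v w)) (trans (⟪⟫-·ˡ c w u) (cong (c *_) (⟪⟫-sym w u)))

  ⟪⟫-0ˡ : ∀ z → ⟪ 0v , z ⟫ ≡ 0ℚ
  ⟪⟫-0ˡ z = trans (⟪⟫-row 0v z) (trans (Σ-cong vanish) (Σ-zero n))
    where
    vanish : ∀ i → lookup 0v i * (G ⊙ lookup z) i ≡ 0ℚ
    vanish i = trans (cong (_* (G ⊙ lookup z) i) (lookup-replicate i 0ℚ)) (*-zeroˡ ((G ⊙ lookup z) i))

  ⟪⟫--ˡ : ∀ u w z → ⟪ u -v w , z ⟫ ≡ ⟪ u , z ⟫ - ⟪ w , z ⟫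
  ⟪⟫--ˡ u w z = begin
    ⟪ u -v w , z ⟫
      ≡⟨ ⟪⟫-row (u -v w) z ⟩
    Σ[< n ] (λ i → lookup (u -v w) i * Gz i)
      ≡⟨ Σ-cong (λ i → trans (cong (_* Gz i) (lookup-zipWith _-_ i u w))
           (solve 3 (λ x y g → (x :- y) :* g := x :* g :+ (:- con 1ℚ) :* (y :* g))
             refl (lookup u i) (lookup w i) (Gz i))) ⟩
    Σ[< n ] (λ i → lookup u i * Gz i + (- 1ℚ) * (lookup w i * Gz i))
      ≡⟨ trans (Σ-+ (λ i → lookup u i * Gz i) (λ i → (- 1ℚ) * (lookup w i * Gz i)))
           (cong (Σ[< n ] (λ i → lookup u i * Gz i) +_) (Σ-*ˡ (- 1ℚ) (λ i → lookup w i * Gz i))) ⟩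
    Σ[< n ] (λ i → lookup u i * Gz i) + (- 1ℚ) * Σ[< n ] (λ i → lookup w i * Gz i)
      ≡⟨ sym (cong₂ (λ p q → p + (- 1ℚ) * q) (⟪⟫-row u z) (⟪⟫-row w z)) ⟩
    ⟪ u , z ⟫ + (- 1ℚ) * ⟪ w , z ⟫
      ≡⟨ solve 2 (λ p q → p :+ (:- con 1ℚ) :* q := p :- q) refl ⟪ u , z ⟫ ⟪ w , z ⟫ ⟩
    ⟪ u , z ⟫ - ⟪ w , z ⟫ ∎
    where Gz = G ⊙ lookup z

  ⟪e,⟫ : ∀ i w → ⟪ e i , w ⟫ ≡ (G ⊙ lookup w) i
  ⟪e,⟫ i w = trans (⟪⟫-row (e i) w) (Σ-e i (G ⊙ lookup w))

  ⟪⟫-expandʳ : ∀ u w → ⟪ u , w ⟫ ≡ Σ[< n ] (λ i → lookup w i * ⟪ u , e i ⟫)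
  ⟪⟫-expandʳ u w = begin
    ⟪ u , w ⟫                                       ≡⟨ ⟪⟫-sym u w ⟩
    ⟪ w , u ⟫                                       ≡⟨ ⟪⟫-row w u ⟩
    Σ[< n ] (λ i → lookup w i * (G ⊙ lookup u) i)  ≡⟨ Σ-cong (λ i → cong (lookup w i *_) (sym (⟪e,⟫ i u))) ⟩
    Σ[< n ] (λ i → lookup w i * ⟪ e i , u ⟫)        ≡⟨ Σ-cong (λ i → cong (lookup w i *_) (⟪⟫-sym (e i) u)) ⟩
    Σ[< n ] (λ i → lookup w i * ⟪ u , e i ⟫)        ∎

  root-norm-pos : ∀ {α} → α ∈ Φ → 0ℚ < ⟪ α , α ⟫
  root-norm-pos α∈Φ = <-≤-trans 0<1 (norm≥1 α∈Φ)

  e∈Φ⁺ : ∀ i → e i ∈Φ⁺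
  e∈Φ⁺ i = simple∈Φ i , e-nonneg i
    where
    e-nonneg : ∀ {m} (i j : Fin m) → 0ℚ ≤ lookup (e i) j
    e-nonneg zero    zero    = <⇒≤ 0<1
    e-nonneg zero    (suc j) = ≤-reflexive (sym (lookup∘tabulate (λ _ → 0ℚ) j))
    e-nonneg (suc i) zero    = ≤-refl
    e-nonneg (suc i) (suc j) = e-nonneg i j

  coroot-expansion : ∀ θ x → Σ[< n ] (λ i → corootCoeff θ i * ⟪ x , coroot (e i) ⟫) ≡ ⟪ x , coroot θ ⟫
  coroot-expansion θ x = trans (Σ-cong term) (sym (⟪⟫-expandʳ x (coroot θ)))
    where
    term : ∀ i → corootCoeff θ i * ⟪ x , coroot (e i) ⟫ ≡ lookup (coroot θ) i * ⟪ x , e i ⟫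
    term i = begin
      c * N * inv 2ℚ * ⟪ x , (2ℚ * inv N) ·v e i ⟫
        ≡⟨ cong (c * N * inv 2ℚ *_) (⟪⟫-·ʳ (2ℚ * inv N) x (e i)) ⟩
      c * N * inv 2ℚ * (2ℚ * inv N * ⟪ x , e i ⟫)
        ≡⟨ solve 6 (λ c N i₂ t iN p → c :* N :* i₂ :* (t :* iN :* p) := c :* p :* (N :* iN) :* (t :* i₂))
             refl c N (inv 2ℚ) 2ℚ (inv N) ⟪ x , e i ⟫ ⟩
      c * ⟪ x , e i ⟫ * (N * inv N) * (2ℚ * inv 2ℚ)
        ≡⟨ cong₂ (λ s t → c * ⟪ x , e i ⟫ * s * t)
             (inv-inverseʳ N (λ N≡0 → <-irrefl (sym N≡0) (root-norm-pos (simple∈Φ i))))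
             (inv-inverseʳ 2ℚ (λ ())) ⟩
      c * ⟪ x , e i ⟫ * 1ℚ * 1ℚ
        ≡⟨ trans (*-identityʳ _) (*-identityʳ _) ⟩
      c * ⟪ x , e i ⟫ ∎
      where
      c = lookup (coroot θ) i
      N = ⟪ e i , e i ⟫
      2ℚ = ℕtoℚ 2

  Translate : V n → (V n → ℚ) → (V n → ℚ) → Set
  Translate y p q = ∀ {α} → α ∈Φ⁺ → p α ≡ q α + ⟪ y , coroot α ⟫

  P-translate : ∀ {y p q} → Translate y p q → ∀ l θ → θ ∈Φ⁺ → P[ l ] θ at p ≡ P[ l ] θ at q
  P-translate {y} {p} {q} p≡q+y l θ θ⁺ = begin
    Σ[< n ] (λ i → corootCoeff θ i * p (e i)) + ℕtoℚ l - p θ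
      ≡⟨ cong₂ (λ s t → s + ℕtoℚ l - t) Σp≡ (p≡q+y θ⁺) ⟩
    (A + Y) + ℕtoℚ l - (q θ + Y)
      ≡⟨ solve 4 (λ a y l q → (a :+ y) :+ l :- (q :+ y) := a :+ l :- q) refl A Y (ℕtoℚ l) (q θ) ⟩
    A + ℕtoℚ l - q θ ∎
    where
    A = Σ[< n ] (λ i → corootCoeff θ i * q (e i))
    Y = ⟪ y , coroot θ ⟫
    Σp≡ : Σ[< n ] (λ i → corootCoeff θ i * p (e i)) ≡ A + Y
    Σp≡ = begin
      Σ[< n ] (λ i → corootCoeff θ i * p (e i))
        ≡⟨ Σ-cong (λ i → trans (cong (corootCoeff θ i *_) (p≡q+y (e∈Φ⁺ i))) (*-distribˡ-+ (corootCoeff θ i) _ _)) ⟩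
      Σ[< n ] (λ i → corootCoeff θ i * q (e i) + corootCoeff θ i * ⟪ y , coroot (e i) ⟫)
        ≡⟨ Σ-+ (λ i → corootCoeff θ i * q (e i)) (λ i → corootCoeff θ i * ⟪ y , coroot (e i) ⟫) ⟩
      A + Σ[< n ] (λ i → corootCoeff θ i * ⟪ y , coroot (e i) ⟫)
        ≡⟨ cong (A +_) (coroot-expansion θ y) ⟩
      A + Y ∎

  ℤΦ-pairing-integral : ∀ {x} → x ∈ℤΦ → ∀ {α} → α ∈ Φ → IsInteger ⟪ x , coroot α ⟫
  ℤΦ-pairing-integral zeroℤΦ {α} _ = ℤ.0ℤ , ⟪⟫-0ˡ (coroot α)
  ℤΦ-pairing-integral (addℤΦ {β} {x} β∈Φ x∈ℤΦ) {α} α∈Φ =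
    subst IsInteger (sym (⟪⟫-+ˡ x β (coroot α)))
      (IsInteger-+ (ℤΦ-pairing-integral x∈ℤΦ α∈Φ) (crystallographic α∈Φ β∈Φ))
  ℤΦ-pairing-integral (subℤΦ {β} {x} β∈Φ x∈ℤΦ) {α} α∈Φ =
    subst IsInteger (sym (⟪⟫--ˡ x β (coroot α)))
      (IsInteger-- (ℤΦ-pairing-integral x∈ℤΦ α∈Φ) (crystallographic α∈Φ β∈Φ))

  G-pd : PositiveDefinite G
  G-pd u k u≢0 = subst (0ℚ <_) ⟪u,u⟫≡ (G-posdef (tabulate u) tabulate-u≢0)
    where
    tabulate-u≢0 : tabulate u ≢ 0v
    tabulate-u≢0 u≡0 = u≢0 (trans (sym (lookup∘tabulate u k))
      (trans (cong (λ v → lookup v k) u≡0) (lookup-replicate k 0ℚ)))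
    ⟪u,u⟫≡ : ⟪ tabulate u , tabulate u ⟫ ≡ quadForm G u
    ⟪u,u⟫≡ = trans (⟪⟫-row (tabulate u) (tabulate u)) (Σ-cong λ i →
      cong₂ _*_ (lookup∘tabulate u i) (Σ-cong λ j → cong (G i j *_) (lookup∘tabulate u j)))

  ρ : V n
  ρ = tabulate (proj₁ (posDef-solve G G-sym G-pd (λ _ → 1ℚ)))

  ⟪ρ,e⟫≡1 : ∀ i → ⟪ ρ , e i ⟫ ≡ 1ℚ
  ⟪ρ,e⟫≡1 i = begin
    ⟪ ρ , e i ⟫            ≡⟨ ⟪⟫-sym ρ (e i) ⟩
    ⟪ e i , ρ ⟫            ≡⟨ ⟪e,⟫ i ρ ⟩
    (G ⊙ lookup ρ) i       ≡⟨ Σ-cong (λ j → cong (G i j *_) (lookup∘tabulate ρ̂ j)) ⟩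
    (G ⊙ ρ̂) i              ≡⟨ proj₂ (posDef-solve G G-sym G-pd (λ _ → 1ℚ)) i ⟩
    1ℚ                     ∎
    where ρ̂ = proj₁ (posDef-solve G G-sym G-pd (λ _ → 1ℚ))

  ⟪ρ,root⟫-pos : ∀ {α} → α ∈Φ⁺ → 0ℚ < ⟪ ρ , α ⟫
  ⟪ρ,root⟫-pos {α} (α∈Φ , α≥0) with Σ-pos⊎zero (lookup α) α≥0
  ... | inj₁ Σα>0 = subst (0ℚ <_) (sym ⟪ρ,α⟫≡Σα) Σα>0
    where
    ⟪ρ,α⟫≡Σα : ⟪ ρ , α ⟫ ≡ Σ[< n ] (lookup α)
    ⟪ρ,α⟫≡Σα = trans (⟪⟫-expandʳ ρ α)
      (Σ-cong (λ i → trans (cong (lookup α i *_) (⟪ρ,e⟫≡1 i)) (*-identityʳ (lookup α i))))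
  ... | inj₂ α≡0 = ⊥-elim (<-irrefl (sym ⟪α,α⟫≡0) (root-norm-pos α∈Φ))
    where
    ⟪α,α⟫≡0 : ⟪ α , α ⟫ ≡ 0ℚ
    ⟪α,α⟫≡0 = trans (⟪⟫-expandʳ α α)
      (trans (Σ-cong (λ i → trans (cong (_* ⟪ α , e i ⟫) (α≡0 i)) (*-zeroˡ ⟪ α , e i ⟫))) (Σ-zero n))

  ⟪ρ,coroot⟫-pos : ∀ {α} → α ∈Φ⁺ → 0ℚ < ⟪ ρ , coroot α ⟫
  ⟪ρ,coroot⟫-pos {α} α⁺ = subst (0ℚ <_) (sym (⟪⟫-·ʳ (ℕtoℚ 2 * inv ⟪ α , α ⟫) ρ α))
    (*-pos (*-pos 0<2 (inv-pos (root-norm-pos (proj₁ α⁺)))) (⟪ρ,root⟫-pos α⁺))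

  -- Φ is finite, so ρ can be scaled down until every pairing (v, α^∨) drops below 1.
  alcove-point : Σ (V n) _∈Aₑ
  alcove-point = ε ·v ρ , λ {α} α⁺ →
    let ⟪ρ,α∨⟫≤M = bound (proj₁ α⁺)
        ⟪v,α∨⟫≡ = ⟪⟫-·ˡ ε ρ (coroot α)
    in subst (0ℚ <_) (sym ⟪v,α∨⟫≡) (*-pos ε>0 (⟪ρ,coroot⟫-pos α⁺))
     , subst₂ _<_ (sym ⟪v,α∨⟫≡) ε*[M+1]≡1
         (*-monoʳ-<-pos ε {{positive ε>0}} (≤-<-trans ⟪ρ,α∨⟫≤M M<M+1))
    where
    M = proj₁ (list-bounded (λ β → ⟪ ρ , coroot β ⟫) Φ)
    M≥0 = proj₁ (proj₂ (list-bounded (λ β → ⟪ ρ , coroot β ⟫) Φ))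
    bound = proj₂ (proj₂ (list-bounded (λ β → ⟪ ρ , coroot β ⟫) Φ))
    M<M+1 : M < M + 1ℚ
    M<M+1 = subst (_< M + 1ℚ) (+-identityʳ M) (+-monoʳ-< M 0<1)
    M+1>0 : 0ℚ < M + 1ℚ
    M+1>0 = ≤-<-trans M≥0 M<M+1
    ε = inv (M + 1ℚ)
    ε>0 : 0ℚ < ε
    ε>0 = inv-pos M+1>0
    ε*[M+1]≡1 : ε * (M + 1ℚ) ≡ 1ℚ
    ε*[M+1]≡1 = trans (*-comm ε (M + 1ℚ)) (inv-inverseʳ (M + 1ℚ) (λ M+1≡0 → <-irrefl (sym M+1≡0) M+1>0))

  ι-translate : ∀ {x w̄ κ κ̄} → x ∈ℤΦ → IsIota x w̄ κ → IsIota 0v w̄ κ̄ →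
    Translate x (λ α → ℤtoℚ (κ α)) (λ α → ℤtoℚ (κ̄ α))
  ι-translate {x} {w̄} {κ} {κ̄} x∈ℤΦ ι ῑ {α} α⁺ with ℤΦ-pairing-integral x∈ℤΦ (proj₁ α⁺)
  ... | z , ⟪x,α∨⟫≡z = begin
    ℤtoℚ (κ α)                      ≡⟨ cong ℤtoℚ κ≡z+κ̄ ⟩
    ℤtoℚ (z ℤ.+ κ̄ α)                ≡⟨ ℤtoℚ-+ z (κ̄ α) ⟩
    ℤtoℚ z + ℤtoℚ (κ̄ α)             ≡⟨ +-comm (ℤtoℚ z) (ℤtoℚ (κ̄ α)) ⟩
    ℤtoℚ (κ̄ α) + ℤtoℚ z             ≡⟨ cong (ℤtoℚ (κ̄ α) +_) (sym ⟪x,α∨⟫≡z) ⟩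
    ℤtoℚ (κ̄ α) + ⟪ x , coroot α ⟫   ∎
    where
    v = proj₁ alcove-point
    t = ⟪ actW w̄ v , coroot α ⟫
    ⟪τₓw̄v,α∨⟫≡ : ⟪ actWa x w̄ v , coroot α ⟫ ≡ ℤtoℚ z + t
    ⟪τₓw̄v,α∨⟫≡ = trans (⟪⟫-+ˡ x (actW w̄ v) (coroot α)) (cong (_+ t) ⟪x,α∨⟫≡z)
    ⟪τ₀w̄v,α∨⟫≡ : ⟪ actWa 0v w̄ v , coroot α ⟫ ≡ t
    ⟪τ₀w̄v,α∨⟫≡ = trans (⟪⟫-+ˡ 0v (actW w̄ v) (coroot α))
      (trans (cong (_+ t) (⟪⟫-0ˡ (coroot α))) (+-identityˡ t))
    κ≡z+κ̄ : κ α ≡ z ℤ.+ κ̄ α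
    κ≡z+κ̄ = InOpenUnit-unique
      (subst (InOpenUnit (κ α)) ⟪τₓw̄v,α∨⟫≡ (ι α⁺ v (proj₂ alcove-point)))
      (InOpenUnit-+ z (subst (InOpenUnit (κ̄ α)) ⟪τ₀w̄v,α∨⟫≡ (ῑ α⁺ v (proj₂ alcove-point))))

lemma4p21 : ∀ (n : ℕ) (R : RootSystem n) → let open RootSystem R in
    ∀ (λ' : V n → ℕ) → Admitted λ' →
      (∀ (x : V n) (w̄ : WWord) (κ κ̄ : V n → ℤ) → x ∈ℤΦ →
        IsIota x w̄ κ → IsIota 0v w̄ κ̄ →
        (λ α → ℤtoℚ (κ α)) ∈X[ λ' ] → (λ α → ℤtoℚ (κ̄ α)) ∈X[ λ' ])
      × (∀ (y : V n) → y ∈ℤΦ → ∀ (p : V n → ℚ) → p ∈X[ λ' ] → Fτ y p ∈X[ λ' ])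
lemma4p21 n R λ' _ =
    (λ x w̄ κ κ̄ x∈ℤΦ ι ῑ κ∈X {θ} θ⁺ →
      trans (sym (P-translate {x} (ι-translate {x} {w̄} {κ} {κ̄} x∈ℤΦ ι ῑ) (λ' θ) θ θ⁺)) (κ∈X θ⁺))
  , (λ y _ p p∈X {θ} θ⁺ →
      trans (P-translate {y} {Fτ y p} {p} (λ _ → refl) (λ' θ) θ θ⁺) (p∈X θ⁺))
  where
  open RootSystem R
  open RootSystemFacts R
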